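{- $$ \sum_{k=0}^\infty\frac{1}{2^{6k}}\left(\frac{16}{6k+1}-\frac{24}{6k+2}-\frac{8}{6k+3}-\frac{6}{6k+4}+\frac{1}{6k+5}\right)=0. $$ -}

module Defs where

open import Data.Nat as ℕ using (ℕ; zero; suc; _≥_)
open import Data.Nat.Properties using (m^n≢0)
open import Data.Integer using (+_)
open import Data.Rational using (ℚ; _/_; _+_; _-_; _*_; _<_; ∣_∣; 0ℚ)

weight : ℕ → ℚ
weight k = (+ 1) / (2 ℕ.^ (6 ℕ.* k))
  where instance _ = m^n≢0 2 (6 ℕ.* k)

term : ℕ → ℚ
term k = weight k * ( (+ 16) / suc (6 ℕ.* k)
                    - (+ 24) / suc (suc (6 ℕ.* k))
                    - (+ 8)  / suc (suc (suc (6 ℕ.* k)))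
                    - (+ 6)  / suc (suc (suc (suc (6 ℕ.* k))))
                    + (+ 1)  / suc (suc (suc (suc (suc (6 ℕ.* k))))) )

partialSum : ℕ → ℚ
partialSum zero    = 0ℚ
partialSum (suc n) = partialSum n + term n

ConvergesTo : (ℕ → ℚ) → ℚ → Set
ConvergesTo s L = ∀ (ε : ℚ) → 0ℚ < ε → Σ ℕ λ N → ∀ n → n ≥ N → ∣ s n - L ∣ < ε
  where open import Data.Product using (Σ)

-- Splitting the summand by the residue of its denominator mod 6 gives
--   partialSum N = 32 (L(2N, −1/8) − L(3N, 1/4) − L(6N, −1/2)),
-- where L(n, y) = y + y²/2 + ⋯ + yⁿ/n approximates −log(1 − y). Since 1 + 1/8 = (1 − 1/4)(1 + 1/2),
-- the limit is 32 (log(1 − 1/4) + log(1 + 1/2) − log(1 + 1/8)) = 0.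
-- To avoid logarithms, write c = a + (1 − a) b and expand cᵏ binomially: L(K, c) − L(K, a) is
-- ∑_{m<K} bᵐ⁺¹/(m+1) · P(X > m) for X ~ Bin(K, 1 − a), so L(K, c) − L(K, a) − L(K, b) is bounded by
-- ∑_{m<K} |b|ᵐ⁺¹ P(X ≤ m) = |b|/(1 − |b|) · (E[|b|^X] − |b|ᴷ) ≤ |b|/(1 − |b|) · (a + (1 − a)|b|)ᴷ.
-- With the geometric tails of L(−, 1/4) and L(−, −1/2) this gives |partialSum N| ≤ 96 · 2⁻ᴺ.

module Submission where

open import Algebra.Bundles using (CommutativeRing)
open import Data.Integer as ℤ using (+_)
import Data.Integer.Properties as ℤ
open import Data.Nat as ℕ using (ℕ; zero; suc)
import Data.Nat.Properties as ℕ
open import Data.Rational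
open import Data.Rational.Properties
import Data.Rational.Unnormalised as ℚᵘ
import Data.Rational.Unnormalised.Properties as ℚᵘ
open import Data.Product using (_,_)
open import Data.Unit using (tt)
open import Level using (0ℓ)
open import Relation.Binary.PropositionalEquality
open import Relation.Nullary.Decidable using (dec⇒maybe)
open import Tactic.RingSolver using (solve-∀)
import Data.Nat.Tactic.RingSolver as ℕ-Solver
open import Tactic.RingSolver.Core.AlmostCommutativeRing
  using (AlmostCommutativeRing; fromCommutativeRing)

open import Algebra.Properties.CommutativeSemiring.Exp
  (CommutativeRing.commutativeSemiring +-*-commutativeRing)
  using (_^_; ^-homo-*; ^-assocʳ)
open import Defs

open ≤-Reasoning

ℚ-ring : AlmostCommutativeRing 0ℓ 0ℓ
ℚ-ring = fromCommutativeRing +-*-commutativeRing (λ p → dec⇒maybe (0ℚ ≟ p))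

toℚᵘ-/ : ∀ i n .{{_ : ℕ.NonZero n}} → toℚᵘ (i / n) ℚᵘ.≃ i ℚᵘ./ n
toℚᵘ-/ i (suc n) = toℚᵘ-fromℚᵘ (ℚᵘ.mkℚᵘ i n)

/-≡ : ∀ i j m n .{{_ : ℕ.NonZero m}} .{{_ : ℕ.NonZero n}} →
      i ℤ.* + n ≡ j ℤ.* + m → i / m ≡ j / n
/-≡ i j (suc m) (suc n) eq = fromℚᵘ-cong {ℚᵘ.mkℚᵘ i m} {ℚᵘ.mkℚᵘ j n} (ℚᵘ.*≡* eq)

/-≤ : ∀ i j m n .{{_ : ℕ.NonZero m}} .{{_ : ℕ.NonZero n}} →
      i ℤ.* + n ℤ.≤ j ℤ.* + m → i / m ≤ j / n
/-≤ i j m@(suc _) n@(suc _) le = toℚᵘ-cancel-≤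
  (ℚᵘ.≤-respˡ-≃ (ℚᵘ.≃-sym (toℚᵘ-/ i m)) (ℚᵘ.≤-respʳ-≃ (ℚᵘ.≃-sym (toℚᵘ-/ j n)) (ℚᵘ.*≤* le)))

/-< : ∀ i j m n .{{_ : ℕ.NonZero m}} .{{_ : ℕ.NonZero n}} →
      i ℤ.* + n ℤ.< j ℤ.* + m → i / m < j / n
/-< i j m@(suc _) n@(suc _) lt = toℚᵘ-cancel-<
  (ℚᵘ.<-respˡ-≃ (ℚᵘ.≃-sym (toℚᵘ-/ i m)) (ℚᵘ.<-respʳ-≃ (ℚᵘ.≃-sym (toℚᵘ-/ j n)) (ℚᵘ.*<* lt)))

/-*-/ : ∀ i j m n .{{_ : ℕ.NonZero m}} .{{_ : ℕ.NonZero n}} →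
        (i / m) * (j / n) ≡ ((i ℤ.* j) / (m ℕ.* n)) {{ℕ.m*n≢0 m n}}
/-*-/ i j m@(suc _) n@(suc _) = toℚᵘ-injective (ℚᵘ.≃-trans (toℚᵘ-homo-* (i / m) (j / n))
  (ℚᵘ.≃-trans (ℚᵘ.*-cong (toℚᵘ-/ i m) (toℚᵘ-/ j n))
    (ℚᵘ.≃-sym (toℚᵘ-/ (i ℤ.* j) (m ℕ.* n) {{ℕ.m*n≢0 m n}}))))

1/[1+_] : ℕ → ℚ
1/[1+ n ] = + 1 / suc n

1/n^k≡[1/n]^k : ∀ n k .{{_ : ℕ.NonZero n}} → (+ 1 / n ℕ.^ k) {{ℕ.m^n≢0 n k}} ≡ (+ 1 / n) ^ k
1/n^k≡[1/n]^k n zero    = refl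
1/n^k≡[1/n]^k n (suc k) {{n≢0}} = trans (sym (/-*-/ (+ 1) (+ 1) n (n ℕ.^ k) {{n≢0}} {{ℕ.m^n≢0 n k}}))
                                (cong (+ 1 / n *_) (1/n^k≡[1/n]^k n k))

0≤1/[1+n] : ∀ n → 0ℚ ≤ 1/[1+ n ]
0≤1/[1+n] n = /-≤ (+ 0) (+ 1) 1 (suc n) (ℤ.+≤+ ℕ.z≤n)

1/[1+n]≤1 : ∀ n → 1/[1+ n ] ≤ 1ℚ
1/[1+n]≤1 n = /-≤ (+ 1) (+ 1) (suc n) 1 (ℤ.+≤+ (ℕ.s≤s ℕ.z≤n))

k/n≡k*1/n : ∀ k n → + k / suc n ≡ (+ k / 1) * 1/[1+ n ]
k/n≡k*1/n k n = sym (trans (/-*-/ (+ k) (+ 1) 1 (suc n))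
  (/-cong {{ℕ.m*n≢0 1 (suc n)}} (ℤ.*-identityʳ (+ k)) (ℕ.*-identityˡ (suc n))))

1/n≡k/[k*n] : ∀ k n m → suc m ≡ k ℕ.* suc n → 1/[1+ n ] ≡ + k / suc m
1/n≡k/[k*n] k n m eq = /-≡ (+ 1) (+ k) (suc n) (suc m)
  (trans (ℤ.*-identityˡ (+ suc m)) (trans (cong +_ eq) (ℤ.pos-* k (suc n))))

/1-+ : ∀ i j → (i ℤ.+ j) / 1 ≡ i / 1 + j / 1
/1-+ i j = toℚᵘ-injective (ℚᵘ.≃-trans (toℚᵘ-/ (i ℤ.+ j) 1) (ℚᵘ.≃-sym
  (ℚᵘ.≃-trans (toℚᵘ-homo-+ (i / 1) (j / 1))
    (ℚᵘ.≃-trans (ℚᵘ.+-cong (toℚᵘ-/ i 1) (toℚᵘ-/ j 1))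
      (ℚᵘ.*≡* (cong (ℤ._* + 1) (cong₂ ℤ._+_ (ℤ.*-identityʳ i) (ℤ.*-identityʳ j))))))))

[1+n]*1/[1+n]≡1 : ∀ n → + suc n / 1 * 1/[1+ n ] ≡ 1ℚ
[1+n]*1/[1+n]≡1 n = trans (sym (k/n≡k*1/n (suc n) n)) (/-≡ (+ suc n) (+ 1) (suc n) 1 (ℤ.*-comm (+ suc n) (+ 1)))

1/[1+n]≡k*1/[1+m] : ∀ k n m → suc m ≡ k ℕ.* suc n → 1/[1+ n ] ≡ (+ k / 1) * 1/[1+ m ]
1/[1+n]≡k*1/[1+m] k n m eq = trans (1/n≡k/[k*n] k n m eq) (k/n≡k*1/n k m)

0≤* : ∀ {p q} → 0ℚ ≤ p → 0ℚ ≤ q → 0ℚ ≤ p * q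
0≤* {p} {q} 0≤p 0≤q =
  nonNegative⁻¹ (p * q) {{nonNeg*nonNeg⇒nonNeg p {{nonNegative 0≤p}} q {{nonNegative 0≤q}}}}

*-mono-≤-nonNeg : ∀ {p q r s} → 0ℚ ≤ q → 0ℚ ≤ r → p ≤ q → r ≤ s → p * r ≤ q * s
*-mono-≤-nonNeg {p} {q} {r} {s} 0≤q 0≤r p≤q r≤s =
  ≤-trans (*-monoʳ-≤-nonNeg r {{nonNegative 0≤r}} p≤q) (*-monoˡ-≤-nonNeg q {{nonNegative 0≤q}} r≤s)

p≤q⇒0≤q-p : ∀ {p q} → p ≤ q → 0ℚ ≤ q - p
p≤q⇒0≤q-p {p} p≤q = ≤-trans (≤-reflexive (sym (+-inverseʳ p))) (+-monoˡ-≤ (- p) p≤q)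

p-q≤p : ∀ p {q} → 0ℚ ≤ q → p - q ≤ p
p-q≤p p 0≤q = ≤-trans (+-monoʳ-≤ p (neg-antimono-≤ 0≤q)) (≤-reflexive (+-identityʳ p))

0≤^ : ∀ {y} n → 0ℚ ≤ y → 0ℚ ≤ y ^ n
0≤^ zero    _   = ≤ᵇ⇒≤ tt
0≤^ (suc n) 0≤y = 0≤* 0≤y (0≤^ n 0≤y)

∣^∣ : ∀ y n → ∣ y ^ n ∣ ≡ ∣ y ∣ ^ n
∣^∣ y zero    = refl
∣^∣ y (suc n) = trans (∣p*q∣≡∣p∣*∣q∣ y (y ^ n)) (cong (∣ y ∣ *_) (∣^∣ y n))

^-monoˡ-≤ : ∀ {s t} n → 0ℚ ≤ s → s ≤ t → s ^ n ≤ t ^ n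
^-monoˡ-≤ zero    _   _   = ≤-refl
^-monoˡ-≤ (suc n) 0≤s s≤t = *-mono-≤-nonNeg (≤-trans 0≤s s≤t) (0≤^ n 0≤s) s≤t (^-monoˡ-≤ n 0≤s s≤t)

∑< : ℕ → (ℕ → ℚ) → ℚ
∑< zero    f = 0ℚ
∑< (suc n) f = ∑< n f + f n

syntax ∑< n (λ m → e) = ∑[ m < n ] e

∑-cong : ∀ {f g} n → (∀ m → f m ≡ g m) → ∑< n f ≡ ∑< n g
∑-cong zero    eq = refl
∑-cong (suc n) eq = cong₂ _+_ (∑-cong n eq) (eq n)

∑-suc : ∀ f n → ∑< (suc n) f ≡ f 0 + ∑[ m < n ] f (suc m)
∑-suc f zero    = +-comm 0ℚ (f 0)
∑-suc f (suc n) = trans (cong (_+ f (suc n)) (∑-suc f n)) (+-assoc (f 0) _ _)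

∑-distrib-+ : ∀ f g n → ∑[ m < n ] (f m + g m) ≡ ∑< n f + ∑< n g
∑-distrib-+ f g zero    = refl
∑-distrib-+ f g (suc n) = trans (cong (_+ (f n + g n)) (∑-distrib-+ f g n))
  (interchange (∑< n f) (∑< n g) (f n) (g n))
  where
  interchange : ∀ x y z w → (x + y) + (z + w) ≡ (x + z) + (y + w)
  interchange = solve-∀ ℚ-ring

∑-distrib-- : ∀ f g n → ∑[ m < n ] (f m - g m) ≡ ∑< n f - ∑< n g
∑-distrib-- f g zero    = refl
∑-distrib-- f g (suc n) = trans (cong (_+ (f n - g n)) (∑-distrib-- f g n))
  (interchange (∑< n f) (∑< n g) (f n) (g n))
  where
  interchange : ∀ x y z w → (x - y) + (z - w) ≡ (x + z) - (y + w)
  interchange = solve-∀ ℚ-ring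

*-distribˡ-∑ : ∀ c f n → c * ∑< n f ≡ ∑[ m < n ] (c * f m)
*-distribˡ-∑ c f zero    = *-zeroʳ c
*-distribˡ-∑ c f (suc n) = trans (*-distribˡ-+ c _ _) (cong (_+ c * f n) (*-distribˡ-∑ c f n))

∑-mono-≤ : ∀ {f g} n → (∀ m → f m ≤ g m) → ∑< n f ≤ ∑< n g
∑-mono-≤ zero    le = ≤-refl
∑-mono-≤ (suc n) le = +-mono-≤ (∑-mono-≤ n le) (le n)

∣∑∣≤∑∣∣ : ∀ f n → ∣ ∑< n f ∣ ≤ ∑[ m < n ] ∣ f m ∣
∣∑∣≤∑∣∣ f zero    = ≤-refl
∣∑∣≤∑∣∣ f (suc n) = ≤-trans (∣p+q∣≤∣p∣+∣q∣ (∑< n f) (f n)) (+-monoˡ-≤ ∣ f n ∣ (∣∑∣≤∑∣∣ f n))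

-- The logarithm series

logSum : ℕ → ℚ → ℚ
logSum zero    y = 0ℚ
logSum (suc n) y = logSum n y + y ^ suc n * 1/[1+ n ]

∣y^[1+n]/[1+n]∣≤∣y∣^[1+n] : ∀ y n → ∣ y ^ suc n * 1/[1+ n ] ∣ ≤ ∣ y ∣ ^ suc n
∣y^[1+n]/[1+n]∣≤∣y∣^[1+n] y n = begin
  ∣ y ^ suc n * 1/[1+ n ] ∣      ≡⟨ ∣p*q∣≡∣p∣*∣q∣ (y ^ suc n) (1/[1+ n ]) ⟩
  ∣ y ^ suc n ∣ * ∣ 1/[1+ n ] ∣  ≡⟨ cong₂ _*_ (∣^∣ y (suc n)) (0≤p⇒∣p∣≡p (0≤1/[1+n] n)) ⟩
  ∣ y ∣ ^ suc n * 1/[1+ n ]      ≤⟨ *-monoˡ-≤-nonNeg (∣ y ∣ ^ suc n) {{nonNegative (0≤^ (suc n) (0≤∣p∣ y))}}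
                                                     (1/[1+n]≤1 n) ⟩
  ∣ y ∣ ^ suc n * 1ℚ             ≡⟨ *-identityʳ (∣ y ∣ ^ suc n) ⟩
  ∣ y ∣ ^ suc n                  ∎

logSum-tail : ∀ y → ∣ y ∣ ≤ 1ℚ → ∀ j K →
  (1ℚ - ∣ y ∣) * ∣ logSum (j ℕ.+ K) y - logSum K y ∣ ≤ ∣ y ∣ ^ suc K - ∣ y ∣ ^ suc (j ℕ.+ K)
logSum-tail y ∣y∣≤1 zero    K = ≤-reflexive (begin-equality
  (1ℚ - ∣ y ∣) * ∣ logSum K y - logSum K y ∣  ≡⟨ cong (λ x → (1ℚ - ∣ y ∣) * ∣ x ∣) (+-inverseʳ (logSum K y)) ⟩
  (1ℚ - ∣ y ∣) * 0ℚ                           ≡⟨ *-zeroʳ (1ℚ - ∣ y ∣) ⟩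
  0ℚ                                          ≡⟨ +-inverseʳ (∣ y ∣ ^ suc K) ⟨
  ∣ y ∣ ^ suc K - ∣ y ∣ ^ suc K               ∎)
logSum-tail y ∣y∣≤1 (suc j) K = begin
  (1ℚ - t) * ∣ (logSum n y + y ^ suc n * 1/[1+ n ]) - logSum K y ∣
    ≡⟨ cong (λ x → (1ℚ - t) * ∣ x ∣) (regroup (logSum n y) (logSum K y) (y ^ suc n * 1/[1+ n ])) ⟩
  (1ℚ - t) * ∣ (logSum n y - logSum K y) + y ^ suc n * 1/[1+ n ] ∣
    ≤⟨ *-monoˡ-≤-nonNeg (1ℚ - t) {{nonNegative (p≤q⇒0≤q-p ∣y∣≤1)}}
         (≤-trans (∣p+q∣≤∣p∣+∣q∣ (logSum n y - logSum K y) _)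
                  (+-monoʳ-≤ ∣ logSum n y - logSum K y ∣ (∣y^[1+n]/[1+n]∣≤∣y∣^[1+n] y n))) ⟩
  (1ℚ - t) * (∣ logSum n y - logSum K y ∣ + t ^ suc n)
    ≡⟨ *-distribˡ-+ (1ℚ - t) _ _ ⟩
  (1ℚ - t) * ∣ logSum n y - logSum K y ∣ + (1ℚ - t) * t ^ suc n
    ≤⟨ +-monoˡ-≤ ((1ℚ - t) * t ^ suc n) (logSum-tail y ∣y∣≤1 j K) ⟩
  (t ^ suc K - t ^ suc n) + (1ℚ - t) * t ^ suc n
    ≡⟨ telescope t (t ^ suc K) (t ^ suc n) ⟩
  t ^ suc K - t ^ suc (suc n) ∎
  where
  t = ∣ y ∣
  n = j ℕ.+ K
  regroup : ∀ p q r → (p + r) - q ≡ (p - q) + r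
  regroup = solve-∀ ℚ-ring
  telescope : ∀ t r s → (r - s) + (1ℚ - t) * s ≡ r - t * s
  telescope = solve-∀ ℚ-ring

logSum-block : ∀ y k n → logSum (k ℕ.+ n) y - logSum n y ≡ y ^ n * ∑[ i < k ] (y ^ suc i * 1/[1+ i ℕ.+ n ])
logSum-block y zero    n = trans (+-inverseʳ (logSum n y)) (sym (*-zeroʳ (y ^ n)))
logSum-block y (suc k) n = begin-equality
  (logSum (k ℕ.+ n) y + y ^ suc (k ℕ.+ n) * i) - logSum n y
    ≡⟨ regroup (logSum (k ℕ.+ n) y) (logSum n y) (y ^ suc (k ℕ.+ n) * i) ⟩
  (logSum (k ℕ.+ n) y - logSum n y) + y ^ suc (k ℕ.+ n) * i
    ≡⟨ cong₂ _+_ (logSum-block y k n) (cong (_* i) (^-homo-* y (suc k) n)) ⟩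
  y ^ n * S + y ^ suc k * y ^ n * i
    ≡⟨ factor (y ^ n) S (y ^ suc k) i ⟩
  y ^ n * (S + y ^ suc k * i) ∎
  where
  i = 1/[1+ k ℕ.+ n ]
  S = ∑[ j < k ] (y ^ suc j * 1/[1+ j ℕ.+ n ])
  regroup : ∀ p q r → (p + r) - q ≡ (p - q) + r
  regroup = solve-∀ ℚ-ring
  factor : ∀ p s q i → p * s + q * p * i ≡ p * (s + q * i)
  factor = solve-∀ ℚ-ring

logBlock : ℕ → ℚ → ℕ → ℚ
logBlock k y N = logSum (k ℕ.* suc N) y - logSum (k ℕ.* N) y

logBlock≡ : ∀ y k N → logBlock k y N ≡ (y ^ k) ^ N * ∑[ i < k ] (y ^ suc i * 1/[1+ i ℕ.+ k ℕ.* N ])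
logBlock≡ y k N = begin-equality
  logSum (k ℕ.* suc N) y - logSum (k ℕ.* N) y
    ≡⟨ cong (λ n → logSum n y - logSum (k ℕ.* N) y) (ℕ.*-suc k N) ⟩
  logSum (k ℕ.+ k ℕ.* N) y - logSum (k ℕ.* N) y
    ≡⟨ logSum-block y k (k ℕ.* N) ⟩
  y ^ (k ℕ.* N) * ∑[ i < k ] (y ^ suc i * 1/[1+ i ℕ.+ k ℕ.* N ])
    ≡⟨ cong (_* ∑[ i < k ] (y ^ suc i * 1/[1+ i ℕ.+ k ℕ.* N ])) (^-assocʳ y k N) ⟨
  (y ^ k) ^ N * ∑[ i < k ] (y ^ suc i * 1/[1+ i ℕ.+ k ℕ.* N ]) ∎

-- The binomial distribution

module Binomial (a : ℚ) where

  u : ℚ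
  u = 1ℚ - a

  -- cdf K m = P(X < m) and pmf K m = P(X = m) for X ~ Bin(K, u)
  cdf : ℕ → ℕ → ℚ
  cdf zero    zero    = 0ℚ
  cdf zero    (suc m) = 1ℚ
  cdf (suc K) zero    = 0ℚ
  cdf (suc K) (suc m) = a * cdf K (suc m) + u * cdf K m

  pmf : ℕ → ℕ → ℚ
  pmf K m = cdf K (suc m) - cdf K m

  cdf-zero : ∀ K → cdf K 0 ≡ 0ℚ
  cdf-zero zero    = refl
  cdf-zero (suc K) = refl

  cdf-full : ∀ K m → K ℕ.≤ m → cdf K (suc m) ≡ 1ℚ
  cdf-full zero    m       _         = refl
  cdf-full (suc K) (suc m) (ℕ.s≤s K≤m) = begin-equality
    a * cdf K (suc (suc m)) + u * cdf K (suc m)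
      ≡⟨ cong₂ (λ x y → a * x + u * y) (cdf-full K (suc m) (ℕ.m≤n⇒m≤1+n K≤m)) (cdf-full K m K≤m) ⟩
    a * 1ℚ + u * 1ℚ
      ≡⟨ a+[1-a]≡1 a ⟩
    1ℚ ∎
    where
    a+[1-a]≡1 : ∀ x → x * 1ℚ + (1ℚ - x) * 1ℚ ≡ 1ℚ
    a+[1-a]≡1 = solve-∀ ℚ-ring

  0≤cdf : 0ℚ ≤ a → a ≤ 1ℚ → ∀ K m → 0ℚ ≤ cdf K m
  0≤cdf 0≤a a≤1 zero    zero    = ≤-refl
  0≤cdf 0≤a a≤1 zero    (suc m) = ≤ᵇ⇒≤ tt
  0≤cdf 0≤a a≤1 (suc K) zero    = ≤-refl
  0≤cdf 0≤a a≤1 (suc K) (suc m) =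
    +-mono-≤ (0≤* 0≤a (0≤cdf 0≤a a≤1 K (suc m))) (0≤* (p≤q⇒0≤q-p a≤1) (0≤cdf 0≤a a≤1 K m))

  pmf-zero : ∀ K → pmf K 0 ≡ a ^ K
  pmf-zero zero    = refl
  pmf-zero (suc K) = begin-equality
    (a * cdf K 1 + u * cdf K 0) - 0ℚ  ≡⟨ cong (λ x → (a * cdf K 1 + u * x) - 0ℚ) (cdf-zero K) ⟩
    (a * cdf K 1 + u * 0ℚ) - 0ℚ       ≡⟨ lemma a u (cdf K 1) ⟩
    a * (cdf K 1 - 0ℚ)                ≡⟨ cong (λ x → a * (cdf K 1 - x)) (sym (cdf-zero K)) ⟩
    a * pmf K 0                       ≡⟨ cong (a *_) (pmf-zero K) ⟩
    a ^ suc K                         ∎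
    where
    lemma : ∀ x y s → (x * s + y * 0ℚ) - 0ℚ ≡ x * (s - 0ℚ)
    lemma = solve-∀ ℚ-ring

  pmf-suc : ∀ K m → pmf (suc K) (suc m) ≡ a * pmf K (suc m) + u * pmf K m
  pmf-suc K m = lemma a u (cdf K (suc (suc m))) (cdf K (suc m)) (cdf K m)
    where
    lemma : ∀ x y r s t → (x * r + y * s) - (x * s + y * t) ≡ x * (r - s) + y * (s - t)
    lemma = solve-∀ ℚ-ring

  pmf-vanishes : ∀ K m → K ℕ.≤ m → pmf K (suc m) ≡ 0ℚ
  pmf-vanishes K m K≤m = begin-equality
    cdf K (suc (suc m)) - cdf K (suc m)
      ≡⟨ cong₂ _-_ (cdf-full K (suc m) (ℕ.m≤n⇒m≤1+n K≤m)) (cdf-full K m K≤m) ⟩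
    1ℚ - 1ℚ ≡⟨ +-inverseʳ 1ℚ ⟩
    0ℚ ∎

  ∑-pmf-extend : ∀ z K → ∑[ m < suc (suc K) ] (z ^ m * pmf K m) ≡ ∑[ m < suc K ] (z ^ m * pmf K m)
  ∑-pmf-extend z K = begin-equality
    E + z ^ suc K * pmf K (suc K)  ≡⟨ cong (λ x → E + z ^ suc K * x) (pmf-vanishes K K ℕ.≤-refl) ⟩
    E + z ^ suc K * 0ℚ             ≡⟨ cong (λ x → E + x) (*-zeroʳ (z ^ suc K)) ⟩
    E + 0ℚ                         ≡⟨ +-identityʳ E ⟩
    E                              ∎
    where
    E : ℚ
    E = ∑[ m < suc K ] (z ^ m * pmf K m)

  binomial-theorem : ∀ z K → ∑[ m < suc K ] (z ^ m * pmf K m) ≡ (a + u * z) ^ K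
  binomial-theorem z zero    = refl
  binomial-theorem z (suc K) = begin-equality
    ∑[ m < suc (suc K) ] (z ^ m * pmf (suc K) m)
      ≡⟨ ∑-suc _ (suc K) ⟩
    1ℚ * pmf (suc K) 0 + ∑[ m < suc K ] (z ^ suc m * pmf (suc K) (suc m))
      ≡⟨ cong₂ _+_ (cong (1ℚ *_) (trans (pmf-zero (suc K)) (cong (a *_) (sym (pmf-zero K)))))
                   (∑-cong (suc K) (λ m → cong (z ^ suc m *_) (pmf-suc K m))) ⟩
    1ℚ * (a * pmf K 0) + ∑[ m < suc K ] (z ^ suc m * (a * pmf K (suc m) + u * pmf K m))
      ≡⟨ cong (λ s → 1ℚ * (a * pmf K 0) + s) (trans (∑-cong (suc K) split) (∑-distrib-+ _ _ (suc K))) ⟩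
    1ℚ * (a * pmf K 0) + (∑[ m < suc K ] (a * (z ^ suc m * pmf K (suc m)))
                        + ∑[ m < suc K ] ((u * z) * (z ^ m * pmf K m)))
      ≡⟨ cong₂ (λ s t → 1ℚ * (a * pmf K 0) + (s + t)) (sym (*-distribˡ-∑ a _ (suc K))) (sym (*-distribˡ-∑ (u * z) _ (suc K))) ⟩
    1ℚ * (a * pmf K 0) + (a * ∑[ m < suc K ] (z ^ suc m * pmf K (suc m)) + (u * z) * E)
      ≡⟨ regroup a (u * z) (pmf K 0) (∑[ m < suc K ] (z ^ suc m * pmf K (suc m))) E ⟩
    a * (1ℚ * pmf K 0 + ∑[ m < suc K ] (z ^ suc m * pmf K (suc m))) + (u * z) * E
      ≡⟨ cong (λ s → a * s + (u * z) * E) shifted ⟩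
    a * E + (u * z) * E
      ≡⟨ sym (*-distribʳ-+ E a (u * z)) ⟩
    (a + u * z) * E
      ≡⟨ cong ((a + u * z) *_) (binomial-theorem z K) ⟩
    (a + u * z) ^ suc K ∎
    where
    E = ∑[ m < suc K ] (z ^ m * pmf K m)

    split : ∀ m → z ^ suc m * (a * pmf K (suc m) + u * pmf K m)
                ≡ a * (z ^ suc m * pmf K (suc m)) + (u * z) * (z ^ m * pmf K m)
    split m = lemma z (z ^ m) a u (pmf K (suc m)) (pmf K m)
      where
      lemma : ∀ z p x y r s → (z * p) * (x * r + y * s) ≡ x * ((z * p) * r) + (y * z) * (p * s)
      lemma = solve-∀ ℚ-ring

    regroup : ∀ x y p s e → 1ℚ * (x * p) + (x * s + y * e) ≡ x * (1ℚ * p + s) + y * e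
    regroup = solve-∀ ℚ-ring

    shifted : 1ℚ * pmf K 0 + ∑[ m < suc K ] (z ^ suc m * pmf K (suc m)) ≡ E
    shifted = trans (sym (∑-suc (λ m → z ^ m * pmf K m) (suc K))) (∑-pmf-extend z K)

  -- (m + 1) C(K + 1, m + 1) = (K + 1) C(K, m), as pmf K m = C(K, m) uᵐ aᴷ⁻ᵐ
  absorption : ∀ K m → + suc m / 1 * pmf (suc K) (suc m) ≡ + suc K / 1 * (u * pmf K m)
  absorption zero zero = lemma a
    where
    lemma : ∀ x → 1ℚ * ((x * 1ℚ + (1ℚ - x) * 1ℚ) - (x * 1ℚ + (1ℚ - x) * 0ℚ)) ≡ 1ℚ * ((1ℚ - x) * (1ℚ - 0ℚ))
    lemma = solve-∀ ℚ-ring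
  absorption zero (suc m) = begin-equality
    + suc (suc m) / 1 * pmf 1 (suc (suc m))  ≡⟨ cong (+ suc (suc m) / 1 *_) (pmf-vanishes 1 (suc m) (ℕ.s≤s ℕ.z≤n)) ⟩
    + suc (suc m) / 1 * 0ℚ                   ≡⟨ *-zeroʳ (+ suc (suc m) / 1) ⟩
    0ℚ                                       ≡⟨ *-zeroʳ (1ℚ * u) ⟨
    1ℚ * u * 0ℚ                              ≡⟨ cong (λ x → 1ℚ * u * x) (pmf-vanishes 0 m ℕ.z≤n) ⟨
    1ℚ * u * pmf 0 (suc m)                   ≡⟨ *-assoc 1ℚ u _ ⟩
    1ℚ * (u * pmf 0 (suc m))                 ∎
  absorption (suc K) zero = begin-equality
    1ℚ * pmf (suc (suc K)) 1
      ≡⟨ trans (*-identityˡ _) (pmf-suc (suc K) 0) ⟩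
    a * pmf (suc K) 1 + u * pmf (suc K) 0
      ≡⟨ cong₂ (λ x y → a * x + u * y) (trans (sym (*-identityˡ _)) (absorption K 0)) pmf[1+K,0] ⟩
    a * (k * (u * pmf K 0)) + u * (a * pmf K 0)
      ≡⟨ lemma a u k (pmf K 0) ⟩
    (1ℚ + k) * (u * (a * pmf K 0))
      ≡⟨ cong₂ (λ x y → x * (u * y)) (sym (/1-+ (+ 1) (+ suc K))) (sym pmf[1+K,0]) ⟩
    + suc (suc K) / 1 * (u * pmf (suc K) 0) ∎
    where
    k = + suc K / 1
    pmf[1+K,0] : pmf (suc K) 0 ≡ a * pmf K 0
    pmf[1+K,0] = trans (pmf-zero (suc K)) (cong (a *_) (sym (pmf-zero K)))
    lemma : ∀ x y k p → x * (k * (y * p)) + y * (x * p) ≡ (1ℚ + k) * (y * (x * p))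
    lemma = solve-∀ ℚ-ring
  absorption (suc K) (suc m) = begin-equality
    + suc (suc m) / 1 * pmf (suc (suc K)) (suc (suc m))
      ≡⟨ cong₂ _*_ (/1-+ (+ 1) (+ suc m)) (pmf-suc (suc K) (suc m)) ⟩
    (1ℚ + + suc m / 1) * (a * pmf (suc K) (suc (suc m)) + u * pmf (suc K) (suc m))
      ≡⟨ expand a u (+ suc m / 1) (pmf (suc K) (suc (suc m))) (pmf (suc K) (suc m)) ⟩
    a * ((1ℚ + + suc m / 1) * pmf (suc K) (suc (suc m))) + u * (+ suc m / 1 * pmf (suc K) (suc m)) + u * pmf (suc K) (suc m)
      ≡⟨ cong₂ (λ x y → a * x + u * y + u * pmf (suc K) (suc m))
               (trans (cong (_* pmf (suc K) (suc (suc m))) (sym (/1-+ (+ 1) (+ suc m)))) (absorption K (suc m)))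
               (absorption K m) ⟩
    a * (k * (u * pmf K (suc m))) + u * (k * (u * pmf K m)) + u * pmf (suc K) (suc m)
      ≡⟨ collect a u k (pmf K (suc m)) (pmf K m) (u * pmf (suc K) (suc m)) ⟩
    k * (u * (a * pmf K (suc m) + u * pmf K m)) + u * pmf (suc K) (suc m)
      ≡⟨ cong (λ x → k * (u * x) + u * pmf (suc K) (suc m)) (sym (pmf-suc K m)) ⟩
    k * (u * pmf (suc K) (suc m)) + u * pmf (suc K) (suc m)
      ≡⟨ factor k u (pmf (suc K) (suc m)) ⟩
    (1ℚ + k) * (u * pmf (suc K) (suc m))
      ≡⟨ cong (_* (u * pmf (suc K) (suc m))) (sym (/1-+ (+ 1) (+ suc K))) ⟩
    + suc (suc K) / 1 * (u * pmf (suc K) (suc m)) ∎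
    where
    k = + suc K / 1
    expand : ∀ x y n p q → (1ℚ + n) * (x * p + y * q) ≡ x * ((1ℚ + n) * p) + y * (n * q) + y * q
    expand = solve-∀ ℚ-ring
    collect : ∀ x y k p q r → x * (k * (y * p)) + y * (k * (y * q)) + r ≡ k * (y * (x * p + y * q)) + r
    collect = solve-∀ ℚ-ring
    factor : ∀ k y p → k * (y * p) + y * p ≡ (1ℚ + k) * (y * p)
    factor = solve-∀ ℚ-ring

  cdf-suc : ∀ K m → cdf (suc K) (suc m) ≡ cdf K (suc m) - u * pmf K m
  cdf-suc K m = lemma a (cdf K (suc m)) (cdf K m)
    where
    lemma : ∀ x s t → x * s + (1ℚ - x) * t ≡ s - (1ℚ - x) * (s - t)
    lemma = solve-∀ ℚ-ring

  u*pmf/[1+m] : ∀ K m → 1/[1+ m ] * (u * pmf K m) ≡ 1/[1+ K ] * pmf (suc K) (suc m)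
  u*pmf/[1+m] K m = begin-equality
    1/[1+ m ] * (u * pmf K m)
      ≡⟨ *-identityˡ _ ⟨
    1ℚ * (1/[1+ m ] * (u * pmf K m))
      ≡⟨ cong (_* (1/[1+ m ] * (u * pmf K m))) ([1+n]*1/[1+n]≡1 K) ⟨
    (+ suc K / 1 * 1/[1+ K ]) * (1/[1+ m ] * (u * pmf K m))
      ≡⟨ reorder (+ suc K / 1) (1/[1+ K ]) (1/[1+ m ]) (u * pmf K m) ⟩
    1/[1+ K ] * (1/[1+ m ] * (+ suc K / 1 * (u * pmf K m)))
      ≡⟨ cong (λ x → 1/[1+ K ] * (1/[1+ m ] * x)) (absorption K m) ⟨
    1/[1+ K ] * (1/[1+ m ] * (+ suc m / 1 * pmf (suc K) (suc m)))
      ≡⟨ reorder′ (1/[1+ K ]) (1/[1+ m ]) (+ suc m / 1) (pmf (suc K) (suc m)) ⟩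
    1/[1+ K ] * ((+ suc m / 1 * 1/[1+ m ]) * pmf (suc K) (suc m))
      ≡⟨ cong (λ x → 1/[1+ K ] * (x * pmf (suc K) (suc m))) ([1+n]*1/[1+n]≡1 m) ⟩
    1/[1+ K ] * (1ℚ * pmf (suc K) (suc m))
      ≡⟨ cong (1/[1+ K ] *_) (*-identityˡ _) ⟩
    1/[1+ K ] * pmf (suc K) (suc m) ∎
    where
    reorder : ∀ n j i q → (n * j) * (i * q) ≡ j * (i * (n * q))
    reorder = solve-∀ ℚ-ring
    reorder′ : ∀ j i n p → j * (i * (n * p)) ≡ j * ((n * i) * p)
    reorder′ = solve-∀ ℚ-ring

  ∑-pmf-shifted : ∀ z K → ∑[ m < suc K ] (z ^ suc m * pmf (suc K) (suc m)) ≡ (a + u * z) ^ suc K - a ^ suc K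
  ∑-pmf-shifted z K = begin-equality
    T                                          ≡⟨ lemma p T ⟩
    (p + T) - p                                ≡⟨ cong (_- p) (∑-suc (λ m → z ^ m * pmf (suc K) m) (suc K)) ⟨
    ∑[ m < suc (suc K) ] (z ^ m * pmf (suc K) m) - p
                                               ≡⟨ cong₂ _-_ (binomial-theorem z (suc K)) (trans (*-identityˡ _) (pmf-zero (suc K))) ⟩
    (a + u * z) ^ suc K - a ^ suc K            ∎
    where
    T = ∑[ m < suc K ] (z ^ suc m * pmf (suc K) (suc m))
    p = 1ℚ * pmf (suc K) 0
    lemma : ∀ p t → t ≡ (p + t) - p
    lemma = solve-∀ ℚ-ring

  -- logSum K (a + u b) − logSum K a = ∑_{m<K} bᵐ⁺¹/(m+1) · (1 − cdf K (m+1)) falls short of logSum K b by this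
  defect : ℚ → ℕ → ℚ
  defect b K = ∑[ m < K ] (b ^ suc m * 1/[1+ m ] * cdf K (suc m))

  defect-suc : ∀ b K → defect b (suc K)
             ≡ defect b K + b ^ suc K * 1/[1+ K ] - 1/[1+ K ] * ((a + u * b) ^ suc K - a ^ suc K)
  defect-suc b K = begin-equality
    defect b (suc K)
      ≡⟨ ∑-cong (suc K) split ⟩
    ∑[ m < suc K ] (f m - 1/[1+ K ] * (b ^ suc m * pmf (suc K) (suc m)))
      ≡⟨ ∑-distrib-- f _ (suc K) ⟩
    (defect b K + b ^ suc K * 1/[1+ K ] * cdf K (suc K))
      - ∑[ m < suc K ] (1/[1+ K ] * (b ^ suc m * pmf (suc K) (suc m)))
      ≡⟨ cong₂ (λ x y → (defect b K + b ^ suc K * 1/[1+ K ] * x) - y)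
               (cdf-full K K ℕ.≤-refl) (sym (*-distribˡ-∑ (1/[1+ K ]) _ (suc K))) ⟩
    (defect b K + b ^ suc K * 1/[1+ K ] * 1ℚ)
      - 1/[1+ K ] * ∑[ m < suc K ] (b ^ suc m * pmf (suc K) (suc m))
      ≡⟨ cong₂ (λ x y → (defect b K + x) - 1/[1+ K ] * y) (*-identityʳ _) (∑-pmf-shifted b K) ⟩
    defect b K + b ^ suc K * 1/[1+ K ] - 1/[1+ K ] * ((a + u * b) ^ suc K - a ^ suc K) ∎
    where
    f : ℕ → ℚ
    f m = b ^ suc m * 1/[1+ m ] * cdf K (suc m)
    split : ∀ m → b ^ suc m * 1/[1+ m ] * cdf (suc K) (suc m) ≡ f m - 1/[1+ K ] * (b ^ suc m * pmf (suc K) (suc m))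
    split m = begin-equality
      b ^ suc m * 1/[1+ m ] * cdf (suc K) (suc m)
        ≡⟨ cong (b ^ suc m * 1/[1+ m ] *_) (cdf-suc K m) ⟩
      b ^ suc m * 1/[1+ m ] * (cdf K (suc m) - u * pmf K m)
        ≡⟨ lemma (b ^ suc m) (1/[1+ m ]) (cdf K (suc m)) (u * pmf K m) ⟩
      f m - b ^ suc m * (1/[1+ m ] * (u * pmf K m))
        ≡⟨ cong (λ x → f m - b ^ suc m * x) (u*pmf/[1+m] K m) ⟩
      f m - b ^ suc m * (1/[1+ K ] * pmf (suc K) (suc m))
        ≡⟨ cong (λ x → f m - x) (swap (b ^ suc m) (1/[1+ K ]) (pmf (suc K) (suc m))) ⟩
      f m - 1/[1+ K ] * (b ^ suc m * pmf (suc K) (suc m)) ∎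
      where
      lemma : ∀ p i s q → p * i * (s - q) ≡ p * i * s - p * (i * q)
      lemma = solve-∀ ℚ-ring
      swap : ∀ p j q → p * (j * q) ≡ j * (p * q)
      swap = solve-∀ ℚ-ring

  logSum-defect : ∀ b K → logSum K (a + u * b) - logSum K a - logSum K b + defect b K ≡ 0ℚ
  logSum-defect b zero    = refl
  logSum-defect b (suc K) = begin-equality
    (logSum K c + c ^ suc K * i) - (logSum K a + a ^ suc K * i) - (logSum K b + b ^ suc K * i) + defect b (suc K)
      ≡⟨ cong (λ x → (logSum K c + c ^ suc K * i) - (logSum K a + a ^ suc K * i) - (logSum K b + b ^ suc K * i) + x)
              (defect-suc b K) ⟩
    (logSum K c + c ^ suc K * i) - (logSum K a + a ^ suc K * i) - (logSum K b + b ^ suc K * i)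
      + (defect b K + b ^ suc K * i - i * (c ^ suc K - a ^ suc K))
      ≡⟨ telescope (logSum K c) (logSum K a) (logSum K b) (c ^ suc K) (a ^ suc K) (b ^ suc K) i (defect b K) ⟩
    logSum K c - logSum K a - logSum K b + defect b K
      ≡⟨ logSum-defect b K ⟩
    0ℚ ∎
    where
    c = a + u * b
    i = 1/[1+ K ]
    telescope : ∀ lc la lb pc pa pb i d → (lc + pc * i) - (la + pa * i) - (lb + pb * i) + (d + pb * i - i * (pc - pa))
                                        ≡ lc - la - lb + d
    telescope = solve-∀ ℚ-ring

  ∑-cdf : ∀ y K → (1ℚ - y) * ∑[ m < K ] (y ^ suc m * cdf K (suc m)) ≡ y * ((a + u * y) ^ K - y ^ K)
  ∑-cdf y zero    = lemma y
    where
    lemma : ∀ y → (1ℚ - y) * 0ℚ ≡ y * (1ℚ - 1ℚ)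
    lemma = solve-∀ ℚ-ring
  ∑-cdf y (suc K) = begin-equality
    (1ℚ - y) * ∑[ m < suc K ] (y ^ suc m * cdf (suc K) (suc m))
      ≡⟨ cong ((1ℚ - y) *_) (∑-cong (suc K) (λ m → distrib (y ^ suc m) (cdf K (suc m)) (cdf K m))) ⟩
    (1ℚ - y) * ∑[ m < suc K ] (a * (y ^ suc m * cdf K (suc m)) + u * (y ^ suc m * cdf K m))
      ≡⟨ cong ((1ℚ - y) *_) (trans (∑-distrib-+ _ _ (suc K))
           (cong₂ _+_ (sym (*-distribˡ-∑ a _ (suc K))) (sym (*-distribˡ-∑ u _ (suc K))))) ⟩
    (1ℚ - y) * (a * (H + y ^ suc K * cdf K (suc K)) + u * ∑[ m < suc K ] (y ^ suc m * cdf K m))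
      ≡⟨ cong₂ (λ x z → (1ℚ - y) * (a * (H + y ^ suc K * x) + u * z)) (cdf-full K K ℕ.≤-refl) shifted ⟩
    (1ℚ - y) * (a * (H + y ^ suc K * 1ℚ) + u * (y * H))
      ≡⟨ regroup a y H (y ^ K) ⟩
    (a + u * y) * ((1ℚ - y) * H) + a * (1ℚ - y) * (y * y ^ K)
      ≡⟨ cong (λ x → (a + u * y) * x + a * (1ℚ - y) * (y * y ^ K)) (∑-cdf y K) ⟩
    (a + u * y) * (y * ((a + u * y) ^ K - y ^ K)) + a * (1ℚ - y) * (y * y ^ K)
      ≡⟨ close a y ((a + u * y) ^ K) (y ^ K) ⟩
    y * ((a + u * y) ^ suc K - y ^ suc K) ∎
    where
    H = ∑[ m < K ] (y ^ suc m * cdf K (suc m))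
    distrib : ∀ p s t → p * (a * s + u * t) ≡ a * (p * s) + u * (p * t)
    distrib p s t = lemma a u p s t
      where
      lemma : ∀ x y p s t → p * (x * s + y * t) ≡ x * (p * s) + y * (p * t)
      lemma = solve-∀ ℚ-ring
    shifted : ∑[ m < suc K ] (y ^ suc m * cdf K m) ≡ y * H
    shifted = begin-equality
      ∑[ m < suc K ] (y ^ suc m * cdf K m)
        ≡⟨ ∑-suc (λ m → y ^ suc m * cdf K m) K ⟩
      y ^ 1 * cdf K 0 + ∑[ m < K ] (y ^ suc (suc m) * cdf K (suc m))
        ≡⟨ cong₂ _+_ (trans (cong (y ^ 1 *_) (cdf-zero K)) (*-zeroʳ (y ^ 1)))
                     (∑-cong K (λ m → *-assoc y (y ^ suc m) (cdf K (suc m)))) ⟩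
      0ℚ + ∑[ m < K ] (y * (y ^ suc m * cdf K (suc m)))
        ≡⟨ +-identityˡ _ ⟩
      ∑[ m < K ] (y * (y ^ suc m * cdf K (suc m)))
        ≡⟨ *-distribˡ-∑ y _ K ⟨
      y * H ∎
    regroup : ∀ x y h q → (1ℚ - y) * (x * (h + (y * q) * 1ℚ) + (1ℚ - x) * (y * h))
                        ≡ (x + (1ℚ - x) * y) * ((1ℚ - y) * h) + x * (1ℚ - y) * (y * q)
    regroup = solve-∀ ℚ-ring
    close : ∀ x y r q → (x + (1ℚ - x) * y) * (y * (r - q)) + x * (1ℚ - y) * (y * q)
                      ≡ y * ((x + (1ℚ - x) * y) * r - y * q)
    close = solve-∀ ℚ-ring

  logSum-additive : 0ℚ ≤ a → a ≤ 1ℚ → ∀ b → ∣ b ∣ ≤ 1ℚ → ∀ K →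
    (1ℚ - ∣ b ∣) * ∣ logSum K (a + u * b) - logSum K a - logSum K b ∣ ≤ ∣ b ∣ * (a + u * ∣ b ∣) ^ K
  logSum-additive 0≤a a≤1 b ∣b∣≤1 K = begin
    (1ℚ - ∣ b ∣) * ∣ logSum K (a + u * b) - logSum K a - logSum K b ∣
      ≡⟨ cong (λ x → (1ℚ - ∣ b ∣) * ∣ x ∣) (trans (lemma _ (defect b K)) (cong (_- defect b K) (logSum-defect b K))) ⟩
    (1ℚ - ∣ b ∣) * ∣ 0ℚ - defect b K ∣
      ≡⟨ cong ((1ℚ - ∣ b ∣) *_) (trans (cong ∣_∣ (+-identityˡ _)) (∣-p∣≡∣p∣ (defect b K))) ⟩
    (1ℚ - ∣ b ∣) * ∣ defect b K ∣
      ≤⟨ *-monoˡ-≤-nonNeg (1ℚ - ∣ b ∣) {{nonNegative (p≤q⇒0≤q-p ∣b∣≤1)}}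
           (≤-trans (∣∑∣≤∑∣∣ _ K) (∑-mono-≤ K term-bound)) ⟩
    (1ℚ - ∣ b ∣) * ∑[ m < K ] (∣ b ∣ ^ suc m * cdf K (suc m))
      ≡⟨ ∑-cdf ∣ b ∣ K ⟩
    ∣ b ∣ * ((a + u * ∣ b ∣) ^ K - ∣ b ∣ ^ K)
      ≤⟨ *-monoˡ-≤-nonNeg ∣ b ∣ {{nonNegative (0≤∣p∣ b)}} (p-q≤p _ (0≤^ K (0≤∣p∣ b))) ⟩
    ∣ b ∣ * (a + u * ∣ b ∣) ^ K ∎
    where
    lemma : ∀ f d → f ≡ (f + d) - d
    lemma = solve-∀ ℚ-ring
    term-bound : ∀ m → ∣ b ^ suc m * 1/[1+ m ] * cdf K (suc m) ∣ ≤ ∣ b ∣ ^ suc m * cdf K (suc m)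
    term-bound m = begin
      ∣ b ^ suc m * 1/[1+ m ] * cdf K (suc m) ∣
        ≡⟨ ∣p*q∣≡∣p∣*∣q∣ (b ^ suc m * 1/[1+ m ]) (cdf K (suc m)) ⟩
      ∣ b ^ suc m * 1/[1+ m ] ∣ * ∣ cdf K (suc m) ∣
        ≡⟨ cong (∣ b ^ suc m * 1/[1+ m ] ∣ *_) (0≤p⇒∣p∣≡p 0≤c) ⟩
      ∣ b ^ suc m * 1/[1+ m ] ∣ * cdf K (suc m)
        ≤⟨ *-monoʳ-≤-nonNeg (cdf K (suc m)) {{nonNegative 0≤c}} (∣y^[1+n]/[1+n]∣≤∣y∣^[1+n] b m) ⟩
      ∣ b ∣ ^ suc m * cdf K (suc m) ∎
      where
      0≤c : 0ℚ ≤ cdf K (suc m)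
      0≤c = 0≤cdf 0≤a a≤1 K (suc m)

-- Splitting the series by residues mod 6

¼ -⅛ : ℚ
¼  = + 1 / 4
-⅛ = - (+ 1 / 8)

open Binomial ¼ using (logSum-additive)

weight≡[1/64]^ : ∀ k → weight k ≡ (+ 1 / 64) ^ k
weight≡[1/64]^ k = trans (/-cong {+ 1} {_} {+ 1} {{ℕ.m^n≢0 2 (6 ℕ.* k)}} {{ℕ.m^n≢0 64 k}} refl (sym (ℕ.^-*-assoc 2 6 k)))
                         (1/n^k≡[1/n]^k 64 k)

3i+2+6N+1≡3[1+i+2N] : ∀ N i → suc (3 ℕ.* i ℕ.+ 2 ℕ.+ 6 ℕ.* N) ≡ 3 ℕ.* suc (i ℕ.+ 2 ℕ.* N)
3i+2+6N+1≡3[1+i+2N] = ℕ-Solver.solve-∀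

2i+1+6N+1≡2[1+i+3N] : ∀ N i → suc (2 ℕ.* i ℕ.+ 1 ℕ.+ 6 ℕ.* N) ≡ 2 ℕ.* suc (i ℕ.+ 3 ℕ.* N)
2i+1+6N+1≡2[1+i+3N] = ℕ-Solver.solve-∀

module _ (N : ℕ) where

  1/[6N+1+_] : ℕ → ℚ
  1/[6N+1+ i ] = 1/[1+ i ℕ.+ 6 ℕ.* N ]

  term-harmonics : term N ≡ (+ 1 / 64) ^ N * ((+ 16 / 1) * 1/[6N+1+ 0 ] - (+ 24 / 1) * 1/[6N+1+ 1 ]
                                             - (+ 8 / 1) * 1/[6N+1+ 2 ] - (+ 6 / 1) * 1/[6N+1+ 3 ] + 1/[6N+1+ 4 ])
  term-harmonics = cong₂ _*_ (weight≡[1/64]^ N)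
    (cong (_+ 1/[6N+1+ 4 ]) (cong₂ _-_ (cong₂ _-_ (cong₂ _-_ (k/n≡k*1/n 16 (0 ℕ.+ 6 ℕ.* N)) (k/n≡k*1/n 24 (1 ℕ.+ 6 ℕ.* N)))
                                              (k/n≡k*1/n 8 (2 ℕ.+ 6 ℕ.* N)))
                                  (k/n≡k*1/n 6 (3 ℕ.+ 6 ℕ.* N))))

  logBlock-⅛ : logBlock 2 -⅛ N ≡ (+ 1 / 64) ^ N * ∑[ i < 2 ] (-⅛ ^ suc i * ((+ 3 / 1) * 1/[6N+1+ 3 ℕ.* i ℕ.+ 2 ]))
  logBlock-⅛ = trans (logBlock≡ -⅛ 2 N) (cong ((+ 1 / 64) ^ N *_) (∑-cong 2 λ i →
          cong (-⅛ ^ suc i *_) (1/[1+n]≡k*1/[1+m] 3 _ _ (3i+2+6N+1≡3[1+i+2N] N i))))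

  logBlock¼ : logBlock 3 ¼ N ≡ (+ 1 / 64) ^ N * ∑[ i < 3 ] (¼ ^ suc i * ((+ 2 / 1) * 1/[6N+1+ 2 ℕ.* i ℕ.+ 1 ]))
  logBlock¼ = trans (logBlock≡ ¼ 3 N) (cong ((+ 1 / 64) ^ N *_) (∑-cong 3 λ i →
          cong (¼ ^ suc i *_) (1/[1+n]≡k*1/[1+m] 2 _ _ (2i+1+6N+1≡2[1+i+3N] N i))))

  logBlock-½ : logBlock 6 -½ N ≡ (+ 1 / 64) ^ N * ∑[ i < 6 ] (-½ ^ suc i * 1/[6N+1+ i ])
  logBlock-½ = logBlock≡ -½ 6 N

  term≡32*logBlocks : term N ≡ + 32 / 1 * (logBlock 2 -⅛ N - logBlock 3 ¼ N - logBlock 6 -½ N)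
  term≡32*logBlocks = begin-equality
    term N
      ≡⟨ term-harmonics ⟩
    w * ((+ 16 / 1) * 1/[6N+1+ 0 ] - (+ 24 / 1) * 1/[6N+1+ 1 ]
          - (+ 8 / 1) * 1/[6N+1+ 2 ] - (+ 6 / 1) * 1/[6N+1+ 3 ] + 1/[6N+1+ 4 ])
      ≡⟨ identity w (1/[6N+1+ 0 ]) (1/[6N+1+ 1 ]) (1/[6N+1+ 2 ]) (1/[6N+1+ 3 ]) (1/[6N+1+ 4 ]) (1/[6N+1+ 5 ]) ⟩
    + 32 / 1 * (w * ∑[ i < 2 ] (-⅛ ^ suc i * ((+ 3 / 1) * 1/[6N+1+ 3 ℕ.* i ℕ.+ 2 ]))
              - w * ∑[ i < 3 ] (¼ ^ suc i * ((+ 2 / 1) * 1/[6N+1+ 2 ℕ.* i ℕ.+ 1 ]))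
              - w * ∑[ i < 6 ] (-½ ^ suc i * 1/[6N+1+ i ]))
      ≡⟨ cong (+ 32 / 1 *_) (cong₂ _-_ (cong₂ _-_ logBlock-⅛ logBlock¼) logBlock-½) ⟨
    + 32 / 1 * (logBlock 2 -⅛ N - logBlock 3 ¼ N - logBlock 6 -½ N) ∎
    where
    w = (+ 1 / 64) ^ N
    -- the coefficient of x₅, i.e. of 1/(6N + 6), is 32 (3/64 − 2/64 − 1/64) = 0
    identity : ∀ w x₀ x₁ x₂ x₃ x₄ x₅ →
      w * ((+ 16 / 1) * x₀ - (+ 24 / 1) * x₁ - (+ 8 / 1) * x₂ - (+ 6 / 1) * x₃ + x₄)
      ≡ + 32 / 1 * (w * (0ℚ + -⅛ ^ 1 * ((+ 3 / 1) * x₂) + -⅛ ^ 2 * ((+ 3 / 1) * x₅))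
                 - w * (0ℚ + ¼ ^ 1 * ((+ 2 / 1) * x₁) + ¼ ^ 2 * ((+ 2 / 1) * x₃) + ¼ ^ 3 * ((+ 2 / 1) * x₅))
                 - w * (0ℚ + -½ ^ 1 * x₀ + -½ ^ 2 * x₁ + -½ ^ 3 * x₂ + -½ ^ 4 * x₃ + -½ ^ 5 * x₄ + -½ ^ 6 * x₅))
    identity = solve-∀ ℚ-ring

partialSum≡32*logSums : ∀ N → partialSum N ≡ + 32 / 1 * (logSum (2 ℕ.* N) -⅛ - logSum (3 ℕ.* N) ¼ - logSum (6 ℕ.* N) -½)
partialSum≡32*logSums zero    = refl
partialSum≡32*logSums (suc N) = begin-equality
  partialSum N + term N
    ≡⟨ cong₂ _+_ (partialSum≡32*logSums N) (term≡32*logBlocks N) ⟩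
  + 32 / 1 * (logSum (2 ℕ.* N) -⅛ - logSum (3 ℕ.* N) ¼ - logSum (6 ℕ.* N) -½)
    + + 32 / 1 * (logBlock 2 -⅛ N - logBlock 3 ¼ N - logBlock 6 -½ N)
    ≡⟨ telescope (logSum (2 ℕ.* N) -⅛) (logSum (3 ℕ.* N) ¼) (logSum (6 ℕ.* N) -½)
                 (logSum (2 ℕ.* suc N) -⅛) (logSum (3 ℕ.* suc N) ¼) (logSum (6 ℕ.* suc N) -½) ⟩
  + 32 / 1 * (logSum (2 ℕ.* suc N) -⅛ - logSum (3 ℕ.* suc N) ¼ - logSum (6 ℕ.* suc N) -½) ∎
  where
  telescope : ∀ c a b c′ a′ b′ → + 32 / 1 * (c - a - b) + + 32 / 1 * ((c′ - c) - (a′ - a) - (b′ - b))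
                               ≡ + 32 / 1 * (c′ - a′ - b′)
  telescope = solve-∀ ℚ-ring

-- Convergence

≤½^N : ∀ q .{{_ : Positive q}} r N {x} → 0ℚ ≤ r → r ^ 2 ≤ ½ → q * x ≤ q * r ^ (2 ℕ.* N) → x ≤ ½ ^ N
≤½^N q r N {x} 0≤r r²≤½ qx≤qr^2N = begin
  x              ≤⟨ *-cancelˡ-≤-pos q qx≤qr^2N ⟩
  r ^ (2 ℕ.* N)  ≡⟨ ^-assocʳ r 2 N ⟨
  (r ^ 2) ^ N    ≤⟨ ^-monoˡ-≤ N (0≤^ 2 0≤r) r²≤½ ⟩
  ½ ^ N          ∎

-- logSum-additive applies since −1/8 = 1/4 + (3/4)(−1/2); its ratio is 1/4 + (3/4)(1/2) = 5/8
logSums-additive : ∀ N → ∣ logSum (2 ℕ.* N) -⅛ - logSum (2 ℕ.* N) ¼ - logSum (2 ℕ.* N) -½ ∣ ≤ ½ ^ N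
logSums-additive N = ≤½^N ½ (+ 5 / 8) N (≤ᵇ⇒≤ tt) (≤ᵇ⇒≤ tt)
  (logSum-additive (≤ᵇ⇒≤ tt) (≤ᵇ⇒≤ tt) -½ (≤ᵇ⇒≤ tt) (2 ℕ.* N))

logSum¼-tail : ∀ N → ∣ logSum (3 ℕ.* N) ¼ - logSum (2 ℕ.* N) ¼ ∣ ≤ ½ ^ N
logSum¼-tail N = ≤½^N (+ 3 / 4) ¼ N (≤ᵇ⇒≤ tt) (≤ᵇ⇒≤ tt) (begin
  (+ 3 / 4) * ∣ logSum (3 ℕ.* N) ¼ - logSum (2 ℕ.* N) ¼ ∣
    ≡⟨ cong (λ n → (+ 3 / 4) * ∣ logSum n ¼ - logSum (2 ℕ.* N) ¼ ∣) (3N≡N+2N N) ⟩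
  (+ 3 / 4) * ∣ logSum (N ℕ.+ 2 ℕ.* N) ¼ - logSum (2 ℕ.* N) ¼ ∣
    ≤⟨ logSum-tail ¼ (≤ᵇ⇒≤ tt) N (2 ℕ.* N) ⟩
  ¼ ^ suc (2 ℕ.* N) - ¼ ^ suc (N ℕ.+ 2 ℕ.* N)
    ≤⟨ p-q≤p _ (0≤^ {¼} (suc (N ℕ.+ 2 ℕ.* N)) (≤ᵇ⇒≤ tt)) ⟩
  ¼ * ¼ ^ (2 ℕ.* N)
    ≤⟨ *-monoʳ-≤-nonNeg (¼ ^ (2 ℕ.* N)) {{nonNegative (0≤^ {¼} (2 ℕ.* N) (≤ᵇ⇒≤ tt))}} {¼} {+ 3 / 4} (≤ᵇ⇒≤ tt) ⟩
  (+ 3 / 4) * ¼ ^ (2 ℕ.* N) ∎)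
  where
  3N≡N+2N : ∀ N → 3 ℕ.* N ≡ N ℕ.+ 2 ℕ.* N
  3N≡N+2N = ℕ-Solver.solve-∀

logSum-½-tail : ∀ N → ∣ logSum (6 ℕ.* N) -½ - logSum (2 ℕ.* N) -½ ∣ ≤ ½ ^ N
logSum-½-tail N = ≤½^N ½ ½ N (≤ᵇ⇒≤ tt) (≤ᵇ⇒≤ tt) (begin
  ½ * ∣ logSum (6 ℕ.* N) -½ - logSum (2 ℕ.* N) -½ ∣
    ≡⟨ cong (λ n → ½ * ∣ logSum n -½ - logSum (2 ℕ.* N) -½ ∣) (6N≡4N+2N N) ⟩
  ½ * ∣ logSum (4 ℕ.* N ℕ.+ 2 ℕ.* N) -½ - logSum (2 ℕ.* N) -½ ∣
    ≤⟨ logSum-tail -½ (≤ᵇ⇒≤ tt) (4 ℕ.* N) (2 ℕ.* N) ⟩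
  ½ ^ suc (2 ℕ.* N) - ½ ^ suc (4 ℕ.* N ℕ.+ 2 ℕ.* N)
    ≤⟨ p-q≤p _ (0≤^ {½} (suc (4 ℕ.* N ℕ.+ 2 ℕ.* N)) (≤ᵇ⇒≤ tt)) ⟩
  ½ * ½ ^ (2 ℕ.* N) ∎)
  where
  6N≡4N+2N : ∀ N → 6 ℕ.* N ≡ 4 ℕ.* N ℕ.+ 2 ℕ.* N
  6N≡4N+2N = ℕ-Solver.solve-∀

∣partialSum∣≤96*½^ : ∀ N → ∣ partialSum N ∣ ≤ + 96 / 1 * ½ ^ N
∣partialSum∣≤96*½^ N = begin
  ∣ partialSum N ∣
    ≡⟨ cong ∣_∣ (partialSum≡32*logSums N) ⟩
  ∣ + 32 / 1 * (Lc - La′ - Lb′) ∣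
    ≡⟨ ∣p*q∣≡∣p∣*∣q∣ (+ 32 / 1) (Lc - La′ - Lb′) ⟩
  + 32 / 1 * ∣ Lc - La′ - Lb′ ∣
    ≡⟨ cong (λ x → + 32 / 1 * ∣ x ∣) (split Lc La Lb La′ Lb′) ⟩
  + 32 / 1 * ∣ (Lc - La - Lb) - (La′ - La) - (Lb′ - Lb) ∣
    ≤⟨ *-monoˡ-≤-nonNeg (+ 32 / 1) (∣p-q-r∣≤∣p∣+∣q∣+∣r∣ (Lc - La - Lb) (La′ - La) (Lb′ - Lb)) ⟩
  + 32 / 1 * (∣ Lc - La - Lb ∣ + ∣ La′ - La ∣ + ∣ Lb′ - Lb ∣)
    ≤⟨ *-monoˡ-≤-nonNeg (+ 32 / 1) (+-mono-≤ (+-mono-≤ (logSums-additive N) (logSum¼-tail N)) (logSum-½-tail N)) ⟩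
  + 32 / 1 * (½ ^ N + ½ ^ N + ½ ^ N)
    ≡⟨ triple (½ ^ N) ⟩
  + 96 / 1 * ½ ^ N ∎
  where
  Lc  = logSum (2 ℕ.* N) -⅛
  La  = logSum (2 ℕ.* N) ¼
  Lb  = logSum (2 ℕ.* N) -½
  La′ = logSum (3 ℕ.* N) ¼
  Lb′ = logSum (6 ℕ.* N) -½
  split : ∀ c a b a′ b′ → c - a′ - b′ ≡ (c - a - b) - (a′ - a) - (b′ - b)
  split = solve-∀ ℚ-ring
  ∣p-q-r∣≤∣p∣+∣q∣+∣r∣ : ∀ p q r → ∣ p - q - r ∣ ≤ ∣ p ∣ + ∣ q ∣ + ∣ r ∣
  ∣p-q-r∣≤∣p∣+∣q∣+∣r∣ p q r = ≤-trans (∣p-q∣≤∣p∣+∣q∣ (p - q) r) (+-monoˡ-≤ ∣ r ∣ (∣p-q∣≤∣p∣+∣q∣ p q))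
  triple : ∀ x → + 32 / 1 * (x + x + x) ≡ + 96 / 1 * x
  triple = solve-∀ ℚ-ring

n<2^n : ∀ n → n ℕ.< 2 ℕ.^ n
n<2^n zero    = ℕ.s≤s ℕ.z≤n
n<2^n (suc n) = ℕ.+-mono-≤ (ℕ.m^n>0 2 n) (ℕ.≤-trans (n<2^n n) (ℕ.m≤m+n (2 ℕ.^ n) 0))

½^n≤1/[1+n] : ∀ n → ½ ^ n ≤ 1/[1+ n ]
½^n≤1/[1+n] n = ≤-trans (≤-reflexive (sym (1/n^k≡[1/n]^k 2 n)))
  (/-≤ (+ 1) (+ 1) (2 ℕ.^ n) (suc n) {{ℕ.m^n≢0 2 n}}
    (ℤ.*-monoˡ-≤-nonNeg (+ 1) (ℤ.+≤+ (n<2^n n))))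

1/[1+n]-antimono : ∀ {m n} → m ℕ.≤ n → 1/[1+ n ] ≤ 1/[1+ m ]
1/[1+n]-antimono {m} {n} m≤n = /-≤ (+ 1) (+ 1) (suc n) (suc m) (ℤ.*-monoˡ-≤-nonNeg (+ 1) (ℤ.+≤+ (ℕ.s≤s m≤n)))

≤M*½^⇒convergesTo0 : ∀ s M → (∀ n → ∣ s n ∣ ≤ + M / 1 * ½ ^ n) → ConvergesTo s 0ℚ
≤M*½^⇒convergesTo0 s M bound (mkℚ (+ zero)  d _) (*<* (ℤ.+<+ ()))
≤M*½^⇒convergesTo0 s M bound (mkℚ ℤ.-[1+ p ] d _) (*<* ())
≤M*½^⇒convergesTo0 s M bound ε@(mkℚ (+ suc p) d _) _ = N₀ , λ n N₀≤n → begin-strict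
  ∣ s n - 0ℚ ∣         ≡⟨ cong ∣_∣ (+-identityʳ (s n)) ⟩
  ∣ s n ∣              ≤⟨ bound n ⟩
  + M / 1 * ½ ^ n      ≤⟨ *-monoˡ-≤-nonNeg (+ M / 1) {{normalize-nonNeg M 1}} (≤-trans (½^n≤1/[1+n] n) (1/[1+n]-antimono N₀≤n)) ⟩
  + M / 1 * 1/[1+ N₀ ] ≡⟨ k/n≡k*1/n M N₀ ⟨
  + M / suc N₀         <⟨ /-< (+ M) (+ suc p) (suc N₀) (suc d) M/[1+N₀]<1/[1+d] ⟩
  + suc p / suc d      ≡⟨ ↥p/↧p≡p ε ⟩
  ε                    ∎
  where
  N₀ = M ℕ.* suc d
  M/[1+N₀]<1/[1+d] : + M ℤ.* + suc d ℤ.< + suc p ℤ.* + suc N₀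
  M/[1+N₀]<1/[1+d] = subst₂ ℤ._<_ (ℤ.pos-* M (suc d)) (ℤ.pos-* (suc p) (suc N₀))
    (ℤ.+<+ (ℕ.<-≤-trans (ℕ.n<1+n N₀) (ℕ.m≤n*m (suc N₀) (suc p))))

proposition5p4 : ConvergesTo partialSum 0ℚ
proposition5p4 = ≤M*½^⇒convergesTo0 partialSum 96 ∣partialSum∣≤96*½^
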